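{- Let $(\mathcal V,\mathcal T_\#)$ be a spraid derived from $(V,\#,\preccurlyeq)$ and let $E,F\subseteq V$. Then $F\lhd E$ (formal inductive cover) if and only if $F\lhd' E$ (genetic inductive cover).
   Context: Setting: Bishop-style constructive mathematics, with the induction principles for the inductive definitions below. Pre-natural space $(V,\#,\preccurlyeq)$: $V$ countable, $\#,\preccurlyeq$ decidable, $\#$ symmetric irreflexive, $\preccurlyeq$ partial order, $a\preccurlyeq b\wedge c\#b\Rightarrow c\#a$; $a\prec b$ means $a\preccurlyeq b,a\neq b$. Points: sequences $(p_n)$ in $V$ with $p_{n+1}\preccurlyeq p_n$, for each $n$ some $m$ with $p_m\prec p_n$, and for every $a\#b$ some $m$ with $p_m\#a$ or $p_m\#b$. Natural space: maximal dot $\top$ exists and every dot contains a point. $a$ is an immediate successor of $c$ if $a\prec c$ and no $b$ has $a\prec b\prec c$; $\mathrm{suc}(c)$ is the set of these. $(V,\preccurlyeq)$ is a trea if each $a$ has finitely many $b$ with $a\preccurlyeq b$ and all chains of immediate successors from $\top$ to $a$ have the same length $\mathrm{grd}(a)$. A spraid is a natural space whose dots form a trea and in which every infinite strictly decreasing sequence of dots is a point. For $a\in V$, $V_a=\{b: b\preccurlyeq a\}$ with maximal dot $a$. Formal inductive covering $\lhd$ on subsets of $V$: least relation with (1) $b\preccurlyeq c\Rightarrow\{b\}\lhd\{c\}$; (2) $\{a\}\lhd B$ for all $a\in A$ $\Rightarrow A\lhd B$; (3) $A\lhd B\subseteq C\Rightarrow A\lhd C$; (4) $A\lhd B\lhd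 C\Rightarrow A\lhd C$; (5) $\{b\}\lhd\{d:d\prec b\}$. Genetic bars on $V_a$ are defined inductively: $\{a\}$ is a genetic bar on $V_a$; if for every $b\in\mathrm{suc}(a)$, $B_b$ is a genetic bar on $V_b$, then $\bigcup_{b\in\mathrm{suc}(a)}B_b$ is a genetic bar on $V_a$. A set $C$ descends from $D$ if for every $d\in D$ there is $c\in C$ with $d\preccurlyeq c$. $\{a\}\lhd' B$ iff $B$ descends from some genetic bar on $V_a$; $F\lhd' E$ iff $\{a\}\lhd' E$ for every $a\in F$. -}

module Defs where

open import Level using (0ℓ)
open import Data.Nat using (ℕ; zero; suc)
open import Data.Product using (Σ; ∃; _×_; _,_)
open import Data.Sum using (_⊎_)
open import Data.List using (List)
open import Data.List.Membership.Propositional using (_∈_)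
open import Data.Empty using (⊥)
open import Relation.Nullary using (¬_)
open import Relation.Unary using (Pred; ｛_｝; _⊆_)
open import Relation.Binary using (Rel; Decidable)
open import Relation.Binary.PropositionalEquality using (_≡_)
open import Function.Bundles using (_⇔_)

-- Everything is parametrised by a set of dots V and the relations # (apartness)
-- and ≼ (refinement).  Equality of dots is propositional equality.
module _ {V : Set} (_#_ : Rel V 0ℓ) (_≼_ : Rel V 0ℓ) where

  _≺_ : Rel V 0ℓ
  a ≺ b = (a ≼ b) × ¬ (a ≡ b)

  record IsPoint (p : ℕ → V) : Set where
    field
      decreasing : ∀ n → p (suc n) ≼ p n
      shrinking  : ∀ n → ∃ λ m → p m ≺ p n
      separating : ∀ a b → a # b → ∃ λ m → (p m # a) ⊎ (p m # b)

  IsSuc : V → V → Set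
  IsSuc a c = (a ≺ c) × (∀ b → ¬ ((a ≺ b) × (b ≺ c)))

  data Chain (t : V) : V → ℕ → Set where
    here : Chain t t zero
    step : ∀ {c a n} → Chain t c n → IsSuc a c → Chain t a (suc n)

  record IsPreNaturalSpace : Set where
    field
      -- V countable: enumerated by ℕ
      enum      : ℕ → V
      enum-surj : ∀ a → ∃ λ n → enum n ≡ a
      _#?_      : Decidable _#_
      _≼?_      : Decidable _≼_
      #-sym     : ∀ {a b} → a # b → b # a
      #-irrefl  : ∀ {a} → ¬ (a # a)
      ≼-refl    : ∀ {a} → a ≼ a
      ≼-trans   : ∀ {a b c} → a ≼ b → b ≼ c → a ≼ c
      ≼-antisym : ∀ {a b} → a ≼ b → b ≼ a → a ≡ b
      #-≼       : ∀ {a b c} → a ≼ b → c # b → c # a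

  record IsNaturalSpace : Set where
    field
      isPreNaturalSpace : IsPreNaturalSpace
      ⊤         : V
      ⊤-max     : ∀ a → a ≼ ⊤
      dot-point : ∀ a → ∃ λ (p : ℕ → V) → IsPoint p × (∃ λ n → p n ≼ a)

  record IsSpraid : Set where
    field
      isNaturalSpace : IsNaturalSpace
    open IsNaturalSpace isNaturalSpace public
    field
      above-finite : ∀ a → ∃ λ (L : List V) → ∀ b → (a ≼ b) ⇔ (b ∈ L)
      chain-length : ∀ {a m n} → Chain ⊤ a m → Chain ⊤ a n → m ≡ n
      decr-point   : ∀ (p : ℕ → V) → (∀ n → p (suc n) ≺ p n) → IsPoint p

  data _◁_ : Pred V 0ℓ → Pred V 0ℓ → Set₁ where
    cov-≼     : ∀ {b c} → b ≼ c → ｛ b ｝ ◁ ｛ c ｝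
    cov-loc   : ∀ {A B} → (∀ a → A a → ｛ a ｝ ◁ B) → A ◁ B
    cov-mono  : ∀ {A B C} → A ◁ B → B ⊆ C → A ◁ C
    cov-trans : ∀ {A B C} → A ◁ B → B ◁ C → A ◁ C
    cov-strict : ∀ {b} → ｛ b ｝ ◁ (λ d → d ≺ b)

  -- Genetic bars on V_a
  data GeneticBar : V → Pred V 0ℓ → Set₁ where
    gb-single : ∀ {a} → GeneticBar a ｛ a ｝
    gb-union  : ∀ {a} (B : V → Pred V 0ℓ) →
                (∀ b → IsSuc b a → GeneticBar b (B b)) →
                GeneticBar a (λ x → ∃ λ b → IsSuc b a × B b x)

  DescendsFrom : Pred V 0ℓ → Pred V 0ℓ → Set
  DescendsFrom C D = ∀ d → D d → ∃ λ c → C c × (d ≼ c)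

  _◁′₁_ : V → Pred V 0ℓ → Set₁
  a ◁′₁ B = Σ (Pred V 0ℓ) λ G → GeneticBar a G × DescendsFrom B G

  _◁′_ : Pred V 0ℓ → Pred V 0ℓ → Set₁
  F ◁′ E = ∀ a → F a → a ◁′₁ E

module Submission where

-- Both covers are equivalent to the inductive predicate Barred E: a dot is barred when it
-- lies below a dot of E, or when all its immediate successors are barred.  The trea axioms
-- give the one non-formal step: every d ≺ a lies below an immediate successor of a, namely a
-- maximal one among the finitely many dots above d that are strictly below a.  Hence Barred E
-- is closed downwards and absorbs transitivity, and the cover axiom {b} ◁ {d : d ≺ b} becomes
-- the splitting step.  Genetic bars are the derivation trees of Barred, with their bars read
-- off at the leaves.

open import Level using (0ℓ)
open import Data.Empty using (⊥; ⊥-elim)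
open import Data.List using (List; []; _∷_)
open import Data.List.Membership.Propositional using (_∈_)
open import Data.List.Relation.Unary.All as All using (All; []; _∷_; all?)
open import Data.Product using (∃; _×_; _,_; proj₁; proj₂)
open import Function.Bundles using (_⇔_; mk⇔; Equivalence)
open import Function.Construct.Composition using (_⇔-∘_)
open import Function.Construct.Symmetry using (⇔-sym)
open import Relation.Binary using (Rel; Poset; IsDecPartialOrder)
open import Relation.Binary.PropositionalEquality using (_≡_; refl; sym; subst; isEquivalence)
open import Relation.Nullary using (¬_; Dec; yes; no; ¬?; _×-dec_)
open import Relation.Unary using (Pred; ｛_｝; _⊆_)
import Relation.Binary.Construct.NonStrictToStrict as ToStrict
import Relation.Binary.Properties.Poset as PosetProperties
import Defs

-- Only the order structure of the dots matters.
module Bars {V : Set} (_#_ _≼_ : Rel V 0ℓ)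
            (≼-isDecPartialOrder : IsDecPartialOrder _≡_ _≼_)
            (finite-above : ∀ a → ∃ λ (L : List V) → ∀ {b} → a ≼ b → b ∈ L) where

  open IsDecPartialOrder ≼-isDecPartialOrder
    using (_≟_; ≤-respˡ-≈)
    renaming (refl to ≼-refl; trans to ≼-trans; antisym to ≼-antisym; _≤?_ to _≼?_)
  open Defs using (cov-≼; cov-loc; cov-mono; cov-trans; cov-strict; gb-single; gb-union)

  _≺_ : Rel V 0ℓ
  _≺_ = Defs._≺_ _#_ _≼_

  IsSuc : V → V → Set
  IsSuc = Defs.IsSuc _#_ _≼_

  _◁_ : Pred V 0ℓ → Pred V 0ℓ → Set₁
  _◁_ = Defs._◁_ _#_ _≼_

  GeneticBar : V → Pred V 0ℓ → Set₁
  GeneticBar = Defs.GeneticBar _#_ _≼_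

  DescendsFrom : Pred V 0ℓ → Pred V 0ℓ → Set
  DescendsFrom = Defs.DescendsFrom _#_ _≼_

  _◁′₁_ : V → Pred V 0ℓ → Set₁
  _◁′₁_ = Defs._◁′₁_ _#_ _≼_

  _◁′_ : Pred V 0ℓ → Pred V 0ℓ → Set₁
  _◁′_ = Defs._◁′_ _#_ _≼_

  ≺-irrefl : ∀ {a} → ¬ (a ≺ a)
  ≺-irrefl = ToStrict.<-irrefl _≡_ _≼_ refl

  ≼-≺-trans : ∀ {a b c} → a ≼ b → b ≺ c → a ≺ c
  ≼-≺-trans = ToStrict.≤-<-trans _≡_ _≼_ ≼-trans ≼-antisym ≤-respˡ-≈

  _≺?_ : ∀ a b → Dec (a ≺ b)
  _≺?_ = ToStrict.<-decidable _≡_ _≼_ _≟_ _≼?_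

  maximize-below : ∀ {a} (xs : List V) {b} → b ≺ a →
                   ∃ λ b′ → b ≼ b′ × b′ ≺ a × All (λ x → ¬ (b′ ≺ x × x ≺ a)) xs
  maximize-below []       {b} b≺a = b , ≼-refl , b≺a , []
  maximize-below {a} (x ∷ xs) {b} b≺a with (b ≺? x) ×-dec (x ≺? a)
  ... | yes (b≺x , x≺a) =
    let b′ , x≼b′ , b′≺a , maximal = maximize-below xs x≺a
    in  b′ , ≼-trans (proj₁ b≺x) x≼b′ , b′≺a ,
        (λ (b′≺x , _) → ≺-irrefl (≼-≺-trans x≼b′ b′≺x)) ∷ maximal
  ... | no ¬between =
    let b′ , b≼b′ , b′≺a , maximal = maximize-below xs b≺a
    in  b′ , b≼b′ , b′≺a ,
        (λ (b′≺x , x≺a) → ¬between (≼-≺-trans b≼b′ b′≺x , x≺a)) ∷ maximal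

  suc-above : ∀ {d a} → d ≺ a → ∃ λ b → IsSuc b a × d ≼ b
  suc-above {d} d≺a =
    let L , L-complete = finite-above d
        b , d≼b , b≺a , maximal = maximize-below L d≺a
    in  b , (b≺a , λ x (b≺x , x≺a) →
               All.lookup maximal (L-complete (≼-trans d≼b (proj₁ b≺x))) (b≺x , x≺a)) ,
        d≼b

  IsSuc? : ∀ b a → Dec (IsSuc b a)
  IsSuc? b a with b ≺? a
  ... | no b⊀a = no λ (b≺a , _) → b⊀a b≺a
  ... | yes b≺a with all? (λ x → ¬? ((b ≺? x) ×-dec (x ≺? a))) (proj₁ (finite-above b))
  ...   | yes maximal = yes (b≺a , λ x (b≺x , x≺a) →
                          All.lookup maximal (proj₂ (finite-above b) (proj₁ b≺x)) (b≺x , x≺a))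
  ...   | no ¬maximal = no λ (_ , maximal) → ¬maximal (All.tabulate λ {x} _ → maximal x)

  data Barred (E : Pred V 0ℓ) : V → Set where
    below : ∀ {a c} → E c → a ≼ c → Barred E a
    split : ∀ {a} → (∀ b → IsSuc b a → Barred E b) → Barred E a

  Barred-≼ : ∀ {E a d} → Barred E a → d ≼ a → Barred E d
  Barred-≼ (below e a≼c) d≼a = below e (≼-trans d≼a a≼c)
  Barred-≼ {a = a} {d} (split barred) d≼a with a ≼? d
  ... | yes a≼d rewrite ≼-antisym a≼d d≼a = split barred
  ... | no a⋠d =
    let b , b-suc , d≼b = suc-above (d≼a , λ { refl → a⋠d ≼-refl })
    in  Barred-≼ (barred b b-suc) d≼b

  Barred-mono : ∀ {E E′} → E ⊆ E′ → Barred E ⊆ Barred E′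
  Barred-mono E⊆E′ (below e a≼c) = below (E⊆E′ e) a≼c
  Barred-mono E⊆E′ (split barred) = split λ b b-suc → Barred-mono E⊆E′ (barred b b-suc)

  Barred-trans : ∀ {E E′} → E ⊆ Barred E′ → Barred E ⊆ Barred E′
  Barred-trans E⊆ (below e a≼c) = Barred-≼ (E⊆ e) a≼c
  Barred-trans E⊆ (split barred) = split λ b b-suc → Barred-trans E⊆ (barred b b-suc)

  ◁⇒Barred : ∀ {F E} → F ◁ E → F ⊆ Barred E
  ◁⇒Barred (cov-≼ b≼c)          refl = below refl b≼c
  ◁⇒Barred (cov-loc cover)       Fa   = ◁⇒Barred (cover _ Fa) refl
  ◁⇒Barred (cov-mono F◁B B⊆E)    Fa   = Barred-mono B⊆E (◁⇒Barred F◁B Fa)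
  ◁⇒Barred (cov-trans F◁B B◁E)   Fa   = Barred-trans (◁⇒Barred B◁E) (◁⇒Barred F◁B Fa)
  ◁⇒Barred cov-strict            refl = split λ b (b≺a , _) → below b≺a ≼-refl

  Barred⇒◁ : ∀ {E a} → Barred E a → ｛ a ｝ ◁ E
  Barred⇒◁ (below e a≼c) = cov-mono (cov-≼ a≼c) λ { refl → e }
  Barred⇒◁ (split barred) = cov-trans cov-strict (cov-loc λ d d≺a →
    let b , b-suc , d≼b = suc-above d≺a
    in  cov-trans (cov-≼ d≼b) (Barred⇒◁ (barred b b-suc)))

  ◁⇔Barred : ∀ {F E} → F ◁ E ⇔ F ⊆ Barred E
  ◁⇔Barred = mk⇔ ◁⇒Barred λ F⊆ → cov-loc λ _ Fa → Barred⇒◁ (F⊆ Fa)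

  GeneticBar⇒Barred : ∀ {E G a} → GeneticBar a G → DescendsFrom E G → Barred E a
  GeneticBar⇒Barred gb-single descends =
    let _ , e , a≼c = descends _ refl in below e a≼c
  GeneticBar⇒Barred (gb-union G bars) descends =
    split λ b b-suc → GeneticBar⇒Barred (bars b b-suc) λ x Gx → descends x (b , b-suc , Gx)

  -- gb-union takes a family indexed by dots alone; deciding IsSuc turns a family indexed
  -- by immediate-successor proofs into one.
  sucFamily : ∀ a → (∀ b → IsSuc b a → Pred V 0ℓ) → V → Pred V 0ℓ
  sucFamily a G b with IsSuc? b a
  ... | yes b-suc = G b b-suc
  ... | no _      = λ _ → ⊥

  sucFamily-≡ : ∀ {a b} G → IsSuc b a → ∃ λ b-suc → sucFamily a G b ≡ G b b-suc
  sucFamily-≡ {a} {b} G b-suc with IsSuc? b a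
  ... | yes b-suc′ = b-suc′ , refl
  ... | no ¬b-suc  = ⊥-elim (¬b-suc b-suc)

  Barred⇒◁′₁ : ∀ {E a} → Barred E a → a ◁′₁ E
  Barred⇒◁′₁ {a = a} (below e a≼c) = ｛ a ｝ , gb-single , λ { _ refl → _ , e , a≼c }
  Barred⇒◁′₁ {E} {a} (split barred) =
    (λ x → ∃ λ b → IsSuc b a × G b x) , gb-union G bars , descends
    where
    cover : ∀ b → IsSuc b a → b ◁′₁ E
    cover b b-suc = Barred⇒◁′₁ (barred b b-suc)

    G : V → Pred V 0ℓ
    G = sucFamily a λ b b-suc → proj₁ (cover b b-suc)

    bars : ∀ b → IsSuc b a → GeneticBar b (G b)
    bars b b-suc =
      let b-suc′ , G≡ = sucFamily-≡ _ b-suc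
      in  subst (GeneticBar b) (sym G≡) (proj₁ (proj₂ (cover b b-suc′)))

    descends : DescendsFrom E (λ x → ∃ λ b → IsSuc b a × G b x)
    descends x (b , b-suc , Gbx) =
      let b-suc′ , G≡ = sucFamily-≡ _ b-suc
      in  proj₂ (proj₂ (cover b b-suc′)) x (subst (λ P → P x) G≡ Gbx)

  ◁′₁⇒Barred : ∀ {E a} → a ◁′₁ E → Barred E a
  ◁′₁⇒Barred (_ , bar , descends) = GeneticBar⇒Barred bar descends

  ◁′⇔Barred : ∀ {F E} → F ◁′ E ⇔ F ⊆ Barred E
  ◁′⇔Barred = mk⇔ (λ F◁′E {a} Fa → ◁′₁⇒Barred (F◁′E a Fa)) (λ F⊆ _ Fa → Barred⇒◁′₁ (F⊆ Fa))

open Defs using (IsPreNaturalSpace; IsSpraid; _◁_; _◁′_)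

module _ {V : Set} {_#_ _≼_ : Rel V 0ℓ} (S : IsSpraid _#_ _≼_) where
  open IsSpraid S using (isPreNaturalSpace; above-finite)
  open IsPreNaturalSpace isPreNaturalSpace using (≼-refl; ≼-trans; ≼-antisym; _≼?_)

  dotPoset : Poset 0ℓ 0ℓ 0ℓ
  dotPoset = record
    { Carrier        = V
    ; _≈_            = _≡_
    ; _≤_            = _≼_
    ; isPartialOrder = record
      { isPreorder = record
        { isEquivalence = isEquivalence
        ; reflexive     = λ { refl → ≼-refl }
        ; trans         = ≼-trans
        }
      ; antisym    = ≼-antisym
      }
    }

  spraid-isDecPartialOrder : IsDecPartialOrder _≡_ _≼_
  spraid-isDecPartialOrder = PosetProperties.≤-dec⇒isDecPartialOrder dotPoset _≼?_

  spraid-finite-above : ∀ a → ∃ λ (L : List V) → ∀ {b} → a ≼ b → b ∈ L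
  spraid-finite-above a = let L , above⇔∈L = above-finite a in L , λ {b} → Equivalence.to (above⇔∈L b)

mainTheorem10 : {V : Set} (_#_ : Rel V 0ℓ) (_≼_ : Rel V 0ℓ) →
    IsSpraid _#_ _≼_ → (E F : Pred V 0ℓ) →
    _◁_ _#_ _≼_ F E ⇔ _◁′_ _#_ _≼_ F E
mainTheorem10 _#_ _≼_ S E F = ⇔-sym ◁′⇔Barred ⇔-∘ ◁⇔Barred
  where open Bars _#_ _≼_ (spraid-isDecPartialOrder S) (spraid-finite-above S)
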